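{- Let $N$ and $r\geq 3$ be positive integers, with indices in $S_{N,r}$ arranged in lexicographically decreasing order. Then $$E^{(2)}_{N,r}E^{(3)}_{N,r}\cdots E^{(r-1)}_{N,r}=\operatorname{diag}\big(C_{3r-3,r-1},C_{3r-1,r-1},\dots,C_{N-3,r-1}\big).$$
   Context: $S_{N,r}=\{(n_1,\dots,n_r)\in\mathbb Z^r: n_1+\dots+n_r=N,\ n_i\geq 3\text{ odd}\}$. For $f$ a polynomial in one variable and $g$ in $r-1$ variables, $(f\circ g)(x_1,\dots,x_r)=f(x_1)g(x_2,\dots,x_r)+\sum_{i=1}^{r-1}\big(f(x_{i+1}-x_i)g(x_1,\dots,\widehat{x_{i+1}},\dots,x_r)-(-1)^{\deg f}f(x_i-x_{i+1})g(x_1,\dots,\widehat{x_i},\dots,x_r)\big)$ (hats denote omission). $e\binom{m_1,\dots,m_r}{n_1,\dots,n_r}$ is the coefficient of $x_1^{n_1-1}\cdots x_r^{n_r-1}$ in $x_1^{m_1-1}\circ(x_1^{m_2-1}\cdots x_{r-1}^{m_r-1})$. $E_{N,r}$ is the $S_{N,r}\times S_{N,r}$ matrix with $(m,n)$ entry $e\binom{m_1,\dots,m_r}{n_1,\dots,n_r}$; for $2\le j\le r$, $E^{(j)}_{N,r}$ has $(m,n)$ entry $\delta_{(m_1,\dots,m_{r-j}),(n_1,\dots,n_{r-j})}\,e\binom{m_{r-j+1},\dots,m_r}{n_{r-j+1},\dots,n_r}$ (Kronecker delta), so $E^{(r)}_{N,r}=E_{N,r}$. $C_{N,r}=E^{(2)}_{N,r}\cdots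 E^{(r-1)}_{N,r}E_{N,r}$ (for $r=2$, $C_{N,2}=E_{N,2}$). -}

module Defs where

open import Data.Bool using (Bool; true; false; if_then_else_; _∧_)
open import Data.Nat as ℕ using (ℕ; zero; suc; _∸_; _≡ᵇ_; _≤ᵇ_; _%_)
open import Data.Integer as ℤ using (ℤ; +_; -_)
open import Data.List as L using (List; []; _∷_; _++_; map; filterᵇ; downFrom; upTo;
  concatMap; replicate; length; zipWith; zip; foldr; take; drop)
open import Data.Nat.ListAction using (sum)
open import Data.Bool.ListAction using (all)
open import Data.Vec as V using (Vec)
open import Data.Fin using (Fin; zero; suc; inject₁; punchIn)
open import Data.Product using (_×_; _,_)
open import Relation.Nullary.Decidable using (⌊_⌋)
import Data.List.Properties as LP

-- Polynomials in r variables x₀,…,x_{r-1} over ℤ, as formal sums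
-- (lists) of terms  c · x^u  with exponent vector u.

Mono : ℕ → Set
Mono r = Vec ℕ r

Poly : ℕ → Set
Poly r = List (ℤ × Mono r)

coeff : {r : ℕ} → Poly r → List ℕ → ℤ
coeff [] t = + 0
coeff ((c , u) ∷ p) t =
  (if ⌊ LP.≡-dec ℕ._≟_ (V.toList u) t ⌋ then c else + 0) ℤ.+ coeff p t

_⊕_ : {r : ℕ} → Poly r → Poly r → Poly r
p ⊕ q = p ++ q

⊝_ : {r : ℕ} → Poly r → Poly r
⊝ p = map (λ { (c , u) → (ℤ.- c , u) }) p

_⊗_ : {r : ℕ} → Poly r → Poly r → Poly r
p ⊗ q = concatMap (λ { (c , u) → map (λ { (d , v) → (c ℤ.* d , V.zipWith ℕ._+_ u v) }) q }) p

one : {r : ℕ} → Poly r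
one {r} = (+ 1 , V.replicate r 0) ∷ []

_^ᴾ_ : {r : ℕ} → Poly r → ℕ → Poly r
p ^ᴾ zero = one
p ^ᴾ suc k = p ⊗ (p ^ᴾ k)

var : {r : ℕ} → Fin r → Poly r
var {r} i = (+ 1 , V.updateAt (V.replicate r 0) i (λ _ → 1)) ∷ []

monomial : {r : ℕ} → Mono r → Poly r
monomial u = (+ 1 , u) ∷ []

subst : {s r : ℕ} → (Fin s → Poly r) → Poly s → Poly r
subst {s} σ [] = []
subst {s} σ ((c , u) ∷ p) =
  (map (λ { (d , v) → (c ℤ.* d , v) })
       (V.foldr (λ _ → Poly _) _⊗_ one (V.zipWith _^ᴾ_ (V.tabulate σ) u)))
  ⊕ subst σ p

-- Paper's x_1,…,x_r are here
-- x₀,…,x_s; paper's index i ∈ {1..r-1} is here i : Fin s, with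
-- paper x_i = inject₁ i and paper x_{i+1} = suc i.

minusOnePowIsOne : ℕ → Bool
minusOnePowIsOne d = d % 2 ≡ᵇ 0

circ : {s : ℕ} → (f : Poly 1) → (degf : ℕ) → Poly s → Poly (suc s)
circ {s} f degf g =
  (subst (λ _ → var zero) f ⊗ subst (λ j → var (suc j)) g)
  ⊕ L.foldr _⊕_ [] (L.map term (L.allFin s))
  where
  f[_-_] : Fin (suc s) → Fin (suc s) → Poly (suc s)
  f[ a - b ] = subst (λ _ → var a ⊕ (⊝ var b)) f
  g-omit : Fin (suc s) → Poly (suc s)
  g-omit k = subst (λ j → var (punchIn k j)) g
  term : Fin s → Poly (suc s)
  term i =
    (f[ suc i - inject₁ i ] ⊗ g-omit (suc i))
    ⊕ (if minusOnePowIsOne degf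
        then ⊝ (f[ inject₁ i - suc i ] ⊗ g-omit (inject₁ i))
        else    f[ inject₁ i - suc i ] ⊗ g-omit (inject₁ i))

-- e(m₁,…,m_r ; n₁,…,n_r): coefficient of x₁^{n₁-1}⋯x_r^{n_r-1} in
-- x₁^{m₁-1} ∘ (x₁^{m₂-1}⋯x_{r-1}^{m_r-1}).
e : List ℕ → List ℕ → ℤ
e [] n = + 0
e (m₁ ∷ ms) n =
  coeff (circ (monomial (V.[ m₁ ∸ 1 ])) (m₁ ∸ 1)
              (monomial (V.fromList (map (λ a → a ∸ 1) ms))))
        (map (λ a → a ∸ 1) n)

allTuples : ℕ → (r : ℕ) → List (List ℕ)
allTuples N zero = [] ∷ []
allTuples N (suc r) = concatMap (λ a → map (a ∷_) (allTuples N r)) (downFrom (suc N))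

oddGe3 : ℕ → Bool
oddGe3 a = (3 ≤ᵇ a) ∧ (a % 2 ≡ᵇ 1)

S : ℕ → ℕ → List (List ℕ)
S N r = filterᵇ (λ t → (sum t ≡ᵇ N) ∧ all oddGe3 t) (allTuples N r)

-- Matrices as lists of rows.

Mat : Set
Mat = List (List ℤ)

matrix : List (List ℕ) → (List ℕ → List ℕ → ℤ) → Mat
matrix I ent = map (λ m → map (λ n → ent m n) I) I

width : Mat → ℕ
width [] = 0
width (row ∷ _) = length row

_·_ : Mat → Mat → Mat
A · B = map rowTimes A
  where
  rowTimes : List ℤ → List ℤ
  rowTimes row = foldr (λ { (c , brow) acc → zipWith ℤ._+_ (map (c ℤ.*_) brow) acc })
                       (replicate (width B) (+ 0)) (zip row B)

mprod : Mat → List Mat → Mat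
mprod A [] = A
mprod A (B ∷ Bs) = A · mprod B Bs

blockDiag : List Mat → Mat
blockDiag [] = []
blockDiag (B ∷ Bs) =
  map (λ row → row ++ replicate (length R) (+ 0)) B
  ++ map (λ row → replicate (length B) (+ 0) ++ row) R
  where R = blockDiag Bs

E[_]_,_ : ℕ → ℕ → ℕ → Mat
E[ j ] N , r = matrix (S N r) (λ m n →
  if ⌊ LP.≡-dec ℕ._≟_ (take (r ∸ j) m) (take (r ∸ j) n) ⌋
  then e (drop (r ∸ j) m) (drop (r ∸ j) n) else + 0)

E_,_ : ℕ → ℕ → Mat
E N , r = E[ r ] N , r

C_,_ : ℕ → ℕ → Mat
C N , r = mprod (E[ 2 ] N , r) (map (λ j → E[ j ] N , r) (map (3 ℕ.+_) (upTo (r ∸ 2))))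

Eprod : ℕ → ℕ → Mat
Eprod N r = mprod (E[ 2 ] N , r) (map (λ j → E[ j ] N , r) (map (3 ℕ.+_) (upTo (r ∸ 3))))

blockSizes : ℕ → ℕ → List ℕ
blockSizes N r = map (λ i → (3 ℕ.* r ∸ 3) ℕ.+ 2 ℕ.* i) (upTo ((N ℕ.+ 2 ∸ 3 ℕ.* r) ℕ./ 2))

module Submission where

-- Write r = s + 1 and group S_{N,s+1} by the first coordinate c = N, …, 0:
-- the tuples starting with c are c ∷ t with t ∈ S_{N-c,s} when c is odd and
-- c ≥ 3, and there are none otherwise.  For j ≤ s an entry of E^{(j)}_{N,s+1}
-- is a Kronecker delta on the first coordinate times a function of the
-- tails, so E^{(j)}_{N,s+1} is block diagonal with blocks E^{(j)}_{N-c,s}.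
-- Products of block diagonal matrices with matching square blocks are
-- computed blockwise, so the product is diag(C_{N-c,s})_c.  Finally
-- S_{K,s} = ∅ for K < 3s, and by the parity hypothesis the remaining
-- non-empty blocks are exactly C_{3s}, C_{3s+2}, …, C_{N-3}.

open import Defs
open import Data.Nat using (ℕ; _≤_; _%_; _∸_)
open import Data.List using (map)
open import Relation.Binary.PropositionalEquality using (_≡_)

open import Data.Nat using (zero; suc; _+_; _*_; _<_; _/_; _≤?_; _≡ᵇ_; z≤n; s≤s)
import Data.Nat.DivMod as DM
open import Data.Nat.Tactic.RingSolver using (solve-∀)
import Data.Nat.Properties as NP
open import Data.Nat.ListAction using (sum)
open import Data.Integer as ℤ using (ℤ; +_)
import Data.Integer.Properties as ZP
open import Data.List using (List; []; _∷_; _++_; length; replicate; zipWith; zip; foldr; concatMap; downFrom; filterᵇ; upTo; applyUpTo; take; drop)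
open import Data.Bool using (Bool; true; false; if_then_else_; _∧_; T)
import Data.Bool.Properties as BP
open import Data.Bool.ListAction using (all)
open import Function.Bundles using (Equivalence)
open import Data.List.Relation.Unary.AllPairs using (_∷_)
open import Data.List.Relation.Unary.Unique.Propositional using (Unique)
open import Relation.Nullary using (¬_; Dec; yes; no)
open import Relation.Nullary.Decidable using (⌊_⌋; T?; isYes≗does; dec-true; dec-false)
open import Data.List.Relation.Unary.Unique.Propositional.Properties using (downFrom⁺)
import Data.List.Properties as LP
open import Data.List.Relation.Unary.All as All using (All; []; _∷_)
import Data.List.Relation.Unary.All.Properties as AllP
open import Data.Product using (_×_; _,_; proj₁; proj₂; ∃)
open import Data.Empty using (⊥-elim)
open import Function using (_∘_)
open import Relation.Binary.PropositionalEquality using (refl; sym; trans; cong; cong₂; module ≡-Reasoning)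
import Relation.Binary.PropositionalEquality as Eq

zeros : ℕ → List ℤ
zeros n = replicate n (+ 0)

addScaled : ℤ × List ℤ → List ℤ → List ℤ
addScaled (c , b) acc = zipWith ℤ._+_ (map (c ℤ.*_) b) acc

combine : List ℤ → List ℤ → Mat → List ℤ
combine acc row B = foldr addScaled acc (zip row B)

rowTimes : Mat → List ℤ → List ℤ
rowTimes B row = combine (zeros (width B)) row B

·-byRows : ∀ A B → A · B ≡ map (rowTimes B) A
·-byRows A B = refl

length-zeros : ∀ n → length (zeros n) ≡ n
length-zeros n = LP.length-replicate n

zeros-+ : ∀ k m → zeros (k + m) ≡ zeros k ++ zeros m
zeros-+ zero m = refl
zeros-+ (suc k) m = cong (+ 0 ∷_) (zeros-+ k m)

zipWith-++ : ∀ {A B C : Set} (f : A → B → C) (xs ys : List A) (us vs : List B) →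
  length xs ≡ length us → zipWith f (xs ++ ys) (us ++ vs) ≡ zipWith f xs us ++ zipWith f ys vs
zipWith-++ f [] ys [] vs eq = refl
zipWith-++ f (x ∷ xs) ys (u ∷ us) vs eq = cong (f x u ∷_) (zipWith-++ f xs ys us vs (NP.suc-injective eq))

length-addScaled : ∀ c b acc → length b ≡ length acc → length (addScaled (c , b) acc) ≡ length acc
length-addScaled c [] [] eq = refl
length-addScaled c (x ∷ b) (a ∷ acc) eq = cong suc (length-addScaled c b acc (NP.suc-injective eq))

length-combine : ∀ acc row B → All (λ b → length b ≡ length acc) B → length (combine acc row B) ≡ length acc
length-combine acc [] B h = refl
length-combine acc (c ∷ row) [] h = refl
length-combine acc (c ∷ row) (b ∷ B) (hb ∷ h) =
  trans (length-addScaled c b _ (trans hb (sym ih))) ih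
  where ih = length-combine acc row B h

combine-++ : ∀ {X : Set} (f g : X → List ℤ) (row : List ℤ) (xs : List X) (a b : List ℤ) →
  All (λ x → length (f x) ≡ length a) xs →
  combine (a ++ b) row (map (λ x → f x ++ g x) xs) ≡ combine a row (map f xs) ++ combine b row (map g xs)
combine-++ f g [] xs a b h = refl
combine-++ f g (c ∷ row) [] a b h = refl
combine-++ f g (c ∷ row) (x ∷ xs) a b (hx ∷ h) =
  begin
    addScaled (c , f x ++ g x) (combine (a ++ b) row (map (λ x → f x ++ g x) xs))
  ≡⟨ cong (addScaled (c , f x ++ g x)) (combine-++ f g row xs a b h) ⟩
    zipWith ℤ._+_ (map (c ℤ.*_) (f x ++ g x)) (A ++ B)
  ≡⟨ cong (λ t → zipWith ℤ._+_ t (A ++ B)) (LP.map-++ (c ℤ.*_) (f x) (g x)) ⟩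
    zipWith ℤ._+_ (map (c ℤ.*_) (f x) ++ map (c ℤ.*_) (g x)) (A ++ B)
  ≡⟨ zipWith-++ ℤ._+_ (map (c ℤ.*_) (f x)) _ A B lengths ⟩
    addScaled (c , f x) A ++ addScaled (c , g x) B
  ∎
  where
  open ≡-Reasoning
  A = combine a row (map f xs)
  B = combine b row (map g xs)
  lengths : length (map (c ℤ.*_) (f x)) ≡ length A
  lengths = trans (LP.length-map (c ℤ.*_) (f x))
              (trans hx (sym (length-combine a row (map f xs) (AllP.map⁺ h))))

combine-zeroCoeffs : ∀ k B acc → All (λ b → length b ≡ length acc) B → combine acc (zeros k) B ≡ acc
combine-zeroCoeffs zero B acc h = refl
combine-zeroCoeffs (suc k) [] acc h = refl
combine-zeroCoeffs (suc k) (b ∷ B) acc (hb ∷ h) =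
  trans (cong (addScaled (+ 0 , b)) (combine-zeroCoeffs k B acc h)) (zeroCoeff b acc hb)
  where
  zeroCoeff : ∀ b acc → length b ≡ length acc → addScaled (+ 0 , b) acc ≡ acc
  zeroCoeff [] [] eq = refl
  zeroCoeff (x ∷ b) (a ∷ acc) eq = cong₂ _∷_ (ZP.+-identityˡ a) (zeroCoeff b acc (NP.suc-injective eq))

combine-zeroRows : ∀ {X : Set} {m} acc row (xs : List X) → length acc ≡ m →
  combine acc row (map (λ _ → zeros m) xs) ≡ acc
combine-zeroRows acc [] xs refl = refl
combine-zeroRows acc (c ∷ row) [] refl = refl
combine-zeroRows acc (c ∷ row) (x ∷ xs) refl =
  trans (cong (addScaled (c , zeros (length acc))) (combine-zeroRows acc row xs refl)) (zeroRow acc)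
  where
  zeroRow : ∀ acc → addScaled (c , zeros (length acc)) acc ≡ acc
  zeroRow [] = refl
  zeroRow (a ∷ acc) = cong₂ _∷_ (trans (cong (ℤ._+ a) (ZP.*-zeroʳ c)) (ZP.+-identityˡ a)) (zeroRow acc)

Square : ℕ → Mat → Set
Square n M = length M ≡ n × All (λ row → length row ≡ n) M

width-Square : ∀ {n} M → Square n M → width M ≡ n
width-Square [] (refl , _) = refl
width-Square (row ∷ M) (_ , (h ∷ _)) = h

diag₂ : ℕ → ℕ → Mat → Mat → Mat
diag₂ k m C R = map (_++ zeros m) C ++ map (zeros k ++_) R

blockDiag-∷ : ∀ {k m} C Cs → length C ≡ k → length (blockDiag Cs) ≡ m →
  blockDiag (C ∷ Cs) ≡ diag₂ k m C (blockDiag Cs)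
blockDiag-∷ C Cs refl refl = refl

Square-diag₂ : ∀ k m C R → Square k C → Square m R → Square (k + m) (diag₂ k m C R)
Square-diag₂ k m C R (lC , rC) (lR , rR) =
  trans (LP.length-++ (map _ C)) (cong₂ _+_ (trans (LP.length-map _ C) lC) (trans (LP.length-map _ R) lR)) ,
  AllP.++⁺ (AllP.map⁺ (All.map (λ {row} h → trans (LP.length-++ row) (cong₂ _+_ h (length-zeros m))) rC))
           (AllP.map⁺ (All.map (λ {row} h → trans (LP.length-++ (zeros k)) (cong₂ _+_ (length-zeros k) h)) rR))

rowTimes-diag₂ : ∀ k m C R u v → Square k C → Square m R → length u ≡ k →
  rowTimes (diag₂ k m C R) (u ++ v) ≡ rowTimes C u ++ rowTimes R v
rowTimes-diag₂ k m C R u v sC sR lu =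
  begin
    combine (zeros (width (diag₂ k m C R))) (u ++ v) (top ++ bottom)
  ≡⟨ cong₂ (λ w z → foldr addScaled (zeros w) z) (width-Square _ (Square-diag₂ k m C R sC sR))
       (zipWith-++ _,_ u v top bottom (trans lu (sym (trans (LP.length-map _ C) (proj₁ sC))))) ⟩
    foldr addScaled (zeros (k + m)) (zip u top ++ zip v bottom)
  ≡⟨ cong (λ z → foldr addScaled z (zip u top ++ zip v bottom)) (zeros-+ k m) ⟩
    foldr addScaled (zeros k ++ zeros m) (zip u top ++ zip v bottom)
  ≡⟨ LP.foldr-++ addScaled (zeros k ++ zeros m) (zip u top) (zip v bottom) ⟩
    combine (combine (zeros k ++ zeros m) v bottom) u top
  ≡⟨ cong (λ z → combine z u top) bottomPart ⟩
    combine (zeros k ++ vR) u top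
  ≡⟨ combine-++ (λ x → x) (λ _ → zeros m) u C (zeros k) vR
       (All.map (λ h → trans h (sym (length-zeros k))) (proj₂ sC)) ⟩
    combine (zeros k) u (map (λ x → x) C) ++ combine vR u (map (λ _ → zeros m) C)
  ≡⟨ cong₂ _++_ (cong₂ (λ w B → combine (zeros w) u B) (sym (width-Square C sC)) (LP.map-id C))
                (combine-zeroRows vR u C lvR) ⟩
    rowTimes C u ++ vR
  ∎
  where
  open ≡-Reasoning
  top = map (_++ zeros m) C
  bottom = map (zeros k ++_) R
  vR = rowTimes R v
  lvR : length vR ≡ m
  lvR = trans (length-combine _ v R (All.map (λ h → trans h (sym (trans (length-zeros _) (width-Square R sR)))) (proj₂ sR)))
              (trans (length-zeros _) (width-Square R sR))
  bottomPart : combine (zeros k ++ zeros m) v bottom ≡ zeros k ++ vR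
  bottomPart =
    begin
      combine (zeros k ++ zeros m) v (map (λ x → zeros k ++ x) R)
    ≡⟨ combine-++ (λ _ → zeros k) (λ x → x) v R (zeros k) (zeros m) (All.universal (λ _ → refl) R) ⟩
      combine (zeros k) v (map (λ _ → zeros k) R) ++ combine (zeros m) v (map (λ x → x) R)
    ≡⟨ cong₂ _++_ (combine-zeroRows (zeros k) v R (length-zeros k)) (cong₂ (λ w B → combine (zeros w) v B) (sym (width-Square R sR)) (LP.map-id R)) ⟩
      zeros k ++ vR
    ∎

rowsFit : ∀ {n} M → Square n M → All (λ b → length b ≡ length (zeros (width M))) M
rowsFit M sM = All.map (λ h → trans h (sym (trans (length-zeros _) (width-Square M sM)))) (proj₂ sM)

length-rowTimes : ∀ {n} B row → Square n B → length (rowTimes B row) ≡ n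
length-rowTimes B row sB =
  trans (length-combine _ row B (rowsFit B sB)) (trans (length-zeros _) (width-Square B sB))

rowTimes-zeros : ∀ {n} B → Square n B → rowTimes B (zeros n) ≡ zeros n
rowTimes-zeros {n} B sB =
  trans (combine-zeroCoeffs n B _ (rowsFit B sB)) (cong zeros (width-Square B sB))

Square-· : ∀ {n} A B → Square n A → Square n B → Square n (A · B)
Square-· A B sA sB = trans (LP.length-map (rowTimes B) A) (proj₁ sA) ,
  AllP.map⁺ (All.universal (λ row → length-rowTimes B row sB) A)

diag₂-· : ∀ k m B B′ C C′ → Square k B → Square m B′ → Square k C → Square m C′ →
  diag₂ k m B B′ · diag₂ k m C C′ ≡ diag₂ k m (B · C) (B′ · C′)
diag₂-· k m B B′ C C′ sB sB′ sC sC′ =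
  begin
    diag₂ k m B B′ · D
  ≡⟨ ·-byRows (diag₂ k m B B′) D ⟩
    map (rowTimes D) (map (_++ zeros m) B ++ map (zeros k ++_) B′)
  ≡⟨ LP.map-++ (rowTimes D) (map _ B) (map _ B′) ⟩
    map (rowTimes D) (map (_++ zeros m) B) ++ map (rowTimes D) (map (zeros k ++_) B′)
  ≡⟨ cong₂ _++_ (trans (sym (LP.map-∘ B)) (LP.map-cong-local (All.map (λ {b} → topRow {b}) (proj₂ sB))))
                (trans (sym (LP.map-∘ B′)) (LP.map-cong-local (All.map (λ {b} → bottomRow {b}) (proj₂ sB′)))) ⟩
    map (λ b → rowTimes C b ++ zeros m) B ++ map (λ b → zeros k ++ rowTimes C′ b) B′
  ≡⟨ cong₂ _++_ (LP.map-∘ B) (LP.map-∘ B′) ⟩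
    diag₂ k m (B · C) (B′ · C′)
  ∎
  where
  open ≡-Reasoning
  D = diag₂ k m C C′
  topRow : ∀ {b} → length b ≡ k → rowTimes D (b ++ zeros m) ≡ rowTimes C b ++ zeros m
  topRow {b} lb = trans (rowTimes-diag₂ k m C C′ b (zeros m) sC sC′ lb)
                        (cong (rowTimes C b ++_) (rowTimes-zeros C′ sC′))
  bottomRow : ∀ {b} → length b ≡ m → rowTimes D (zeros k ++ b) ≡ zeros k ++ rowTimes C′ b
  bottomRow {b} _ = trans (rowTimes-diag₂ k m C C′ (zeros k) b sC sC′ (length-zeros k))
                          (cong (_++ rowTimes C′ b) (rowTimes-zeros C sC))

Square-blockDiag : ∀ {X : Set} (size : X → ℕ) (B : X → Mat) (xs : List X) →
  All (λ x → Square (size x) (B x)) xs → Square (sum (map size xs)) (blockDiag (map B xs))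
Square-blockDiag size B [] [] = refl , []
Square-blockDiag size B (x ∷ xs) (h ∷ hs) =
  Eq.subst (Square _) (sym (blockDiag-∷ (B x) (map B xs) (proj₁ h) (proj₁ ih)))
    (Square-diag₂ (size x) _ (B x) (blockDiag (map B xs)) h ih)
  where ih = Square-blockDiag size B xs hs

blockDiag-· : ∀ {X : Set} (size : X → ℕ) (B C : X → Mat) (xs : List X) →
  All (λ x → Square (size x) (B x) × Square (size x) (C x)) xs →
  blockDiag (map B xs) · blockDiag (map C xs) ≡ blockDiag (map (λ x → B x · C x) xs)
blockDiag-· size B C [] h = refl
blockDiag-· size B C (x ∷ xs) ((sB , sC) ∷ hs) =
  begin
    blockDiag (map B (x ∷ xs)) · blockDiag (map C (x ∷ xs))
  ≡⟨ cong₂ _·_ (blockDiag-∷ (B x) (map B xs) (proj₁ sB) (proj₁ sB′))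
               (blockDiag-∷ (C x) (map C xs) (proj₁ sC) (proj₁ sC′)) ⟩
    diag₂ k m (B x) B′ · diag₂ k m (C x) C′
  ≡⟨ diag₂-· k m (B x) B′ (C x) C′ sB sB′ sC sC′ ⟩
    diag₂ k m (B x · C x) (B′ · C′)
  ≡⟨ cong (diag₂ k m (B x · C x)) (blockDiag-· size B C xs hs) ⟩
    diag₂ k m (B x · C x) (blockDiag (map BC xs))
  ≡⟨ sym (blockDiag-∷ (B x · C x) (map BC xs) (proj₁ (Square-· (B x) (C x) sB sC))
           (proj₁ (Square-blockDiag size BC xs (All.map (λ (s , t) → Square-· _ _ s t) hs)))) ⟩
    blockDiag (map BC (x ∷ xs))
  ∎
  where
  open ≡-Reasoning
  k = size x
  m = sum (map size xs)
  BC = λ x → B x · C x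
  B′ = blockDiag (map B xs)
  C′ = blockDiag (map C xs)
  sB′ = Square-blockDiag size B xs (All.map proj₁ hs)
  sC′ = Square-blockDiag size C xs (All.map proj₂ hs)

Square-mprod : ∀ {n} A Bs → Square n A → All (Square n) Bs → Square n (mprod A Bs)
Square-mprod A [] sA h = sA
Square-mprod A (B ∷ Bs) sA (sB ∷ h) = Square-· A (mprod B Bs) sA (Square-mprod B Bs sB h)

blockDiag-mprod : ∀ {X J : Set} (size : X → ℕ) (B₀ : X → Mat) (B : J → X → Mat) (xs : List X) (js : List J) →
  (∀ x → Square (size x) (B₀ x)) → (∀ j x → Square (size x) (B j x)) →
  mprod (blockDiag (map B₀ xs)) (map (λ j → blockDiag (map (B j) xs)) js)
    ≡ blockDiag (map (λ x → mprod (B₀ x) (map (λ j → B j x) js)) xs)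
blockDiag-mprod size B₀ B xs [] s₀ s = refl
blockDiag-mprod size B₀ B xs (j ∷ js) s₀ s =
  trans (cong (blockDiag (map B₀ xs) ·_) (blockDiag-mprod size (B j) B xs js (s j) s))
        (blockDiag-· size B₀ (λ x → mprod (B j x) (map (λ j → B j x) js)) xs
          (All.universal (λ x → s₀ x , Square-mprod (B j x) _ (s j x) (squares x js)) xs))
  where
  squares : ∀ x js → All (Square (size x)) (map (λ j → B j x) js)
  squares x js = AllP.map⁺ (All.universal (λ j → s j x) js)

Square-matrix : ∀ (I : List (List ℕ)) f → Square (length I) (matrix I f)
Square-matrix I f = LP.length-map _ I , AllP.map⁺ (All.universal (λ m → LP.length-map (f m) I) I)

prefixed : (ℕ → List (List ℕ)) → List ℕ → List (List ℕ)
prefixed J cs = concatMap (λ c → map (c ∷_) (J c)) cs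

All-prefixed : ∀ {P : List ℕ → Set} J cs → All (λ c → ∀ t → P (c ∷ t)) cs → All P (prefixed J cs)
All-prefixed J [] [] = []
All-prefixed J (c ∷ cs) (h ∷ hs) = AllP.++⁺ (AllP.map⁺ (All.universal h (J c))) (All-prefixed J cs hs)

map-zero : ∀ {A : Set} (f : A → ℤ) xs → All (λ x → f x ≡ + 0) xs → map f xs ≡ zeros (length xs)
map-zero f [] [] = refl
map-zero f (x ∷ xs) (h ∷ hs) = cong₂ _∷_ h (map-zero f xs hs)

matrix-prefixed : ∀ (F G : List ℕ → List ℕ → ℤ) J cs →
  (∀ c m n → F (c ∷ m) (c ∷ n) ≡ G m n) →
  (∀ c d m n → ¬ c ≡ d → F (c ∷ m) (d ∷ n) ≡ + 0) →
  Unique cs →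
  matrix (prefixed J cs) F ≡ blockDiag (map (λ c → matrix (J c) G) cs)
matrix-prefixed F G J [] diag off distinct = refl
matrix-prefixed F G J (c ∷ cs) diag off (c∉cs ∷ distinct) =
  begin
    map (λ x → map (F x) I) (map (c ∷_) Jc ++ I′)
  ≡⟨ LP.map-++ _ (map (c ∷_) Jc) I′ ⟩
    map (λ x → map (F x) I) (map (c ∷_) Jc) ++ map (λ x → map (F x) I) I′
  ≡⟨ cong₂ _++_ (sym (LP.map-∘ Jc)) (LP.map-cong-local (All.map (λ {x} → lowerRow x) lowerLeft)) ⟩
    map (λ t → map (F (c ∷ t)) I) Jc ++ map (λ x → zeros k ++ map (F x) I′) I′
  ≡⟨ cong₂ _++_ (LP.map-cong upperRow Jc) (LP.map-∘ I′) ⟩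
    map (λ t → map (G t) Jc ++ zeros m) Jc ++ map (zeros k ++_) (matrix I′ F)
  ≡⟨ cong₂ _++_ (LP.map-∘ Jc) (cong (map (zeros k ++_)) ih) ⟩
    diag₂ k m (matrix Jc G) R
  ≡⟨ sym (blockDiag-∷ (matrix Jc G) (map (λ c → matrix (J c) G) cs) (LP.length-map _ Jc)
           (trans (cong length (sym ih)) (LP.length-map _ I′))) ⟩
    blockDiag (map (λ c → matrix (J c) G) (c ∷ cs))
  ∎
  where
  open ≡-Reasoning
  Jc = J c
  I′ = prefixed J cs
  I = map (c ∷_) Jc ++ I′
  k = length Jc
  m = length I′
  R = blockDiag (map (λ c → matrix (J c) G) cs)
  ih : matrix I′ F ≡ R
  ih = matrix-prefixed F G J cs diag off distinct
  upperRight : ∀ t → map (F (c ∷ t)) I′ ≡ zeros m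
  upperRight t = map-zero (F (c ∷ t)) I′ (All-prefixed J cs (All.map (λ c≢d n → off c _ t n c≢d) c∉cs))
  upperRow : ∀ t → map (F (c ∷ t)) I ≡ map (G t) Jc ++ zeros m
  upperRow t = trans (LP.map-++ (F (c ∷ t)) (map (c ∷_) Jc) I′)
                 (cong₂ _++_ (trans (sym (LP.map-∘ Jc)) (LP.map-cong (diag c t) Jc)) (upperRight t))
  lowerLeft : All (λ x → map (F x) (map (c ∷_) Jc) ≡ zeros k) I′
  lowerLeft = All-prefixed J cs (All.map (λ c≢d n → trans (sym (LP.map-∘ Jc))
                (map-zero _ Jc (All.universal (λ t → off _ c n t (λ e → c≢d (sym e))) Jc))) c∉cs)
  lowerRow : ∀ x → map (F x) (map (c ∷_) Jc) ≡ zeros k → map (F x) I ≡ zeros k ++ map (F x) I′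
  lowerRow x h = trans (LP.map-++ (F x) (map (c ∷_) Jc) I′) (cong (_++ map (F x) I′) h)

prefixed-cong : ∀ {J J′} cs → All (λ c → J c ≡ J′ c) cs → prefixed J cs ≡ prefixed J′ cs
prefixed-cong [] [] = refl
prefixed-cong (c ∷ cs) (h ∷ hs) = cong₂ _++_ (cong (map (c ∷_)) h) (prefixed-cong cs hs)

filterᵇ-cong : ∀ {A : Set} {p q : A → Bool} → (∀ x → p x ≡ q x) → ∀ xs → filterᵇ p xs ≡ filterᵇ q xs
filterᵇ-cong {p = p} {q} h =
  LP.filter-≐ (T? ∘ p) (T? ∘ q) ((λ {x} → Eq.subst T (h x)) , (λ {x} → Eq.subst T (sym (h x))))

filterᵇ-cons : ∀ (p : List ℕ → Bool) a ts →
  filterᵇ p (map (a ∷_) ts) ≡ map (a ∷_) (filterᵇ (p ∘ (a ∷_)) ts)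
filterᵇ-cons p a [] = refl
filterᵇ-cons p a (t ∷ ts) with p (a ∷ t)
... | true = cong ((a ∷ t) ∷_) (filterᵇ-cons p a ts)
... | false = filterᵇ-cons p a ts

filterᵇ-prefixed : ∀ (p : List ℕ → Bool) J cs →
  filterᵇ p (prefixed J cs) ≡ prefixed (λ c → filterᵇ (p ∘ (c ∷_)) (J c)) cs
filterᵇ-prefixed p J [] = refl
filterᵇ-prefixed p J (c ∷ cs) =
  trans (LP.filter-++ (T? ∘ p) (map (c ∷_) (J c)) _) (cong₂ _++_ (filterᵇ-cons p c (J c)) (filterᵇ-prefixed p J cs))

prefixed-downFrom : ∀ J M d → (∀ c → M < c → J c ≡ []) →
  prefixed J (downFrom (suc (d + M))) ≡ prefixed J (downFrom (suc M))
prefixed-downFrom J M zero h = refl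
prefixed-downFrom J M (suc d) h =
  trans (cong (λ t → map (suc (d + M) ∷_) t ++ prefixed J (downFrom (suc (d + M))))
              (h (suc (d + M)) (s≤s (NP.m≤n+m M d))))
        (prefixed-downFrom J M d h)

filter-allTuples : ∀ r (p : List ℕ → Bool) M N → M ≤ N → (∀ t → T (p t) → All (_≤ M) t) →
  filterᵇ p (allTuples N r) ≡ filterᵇ p (allTuples M r)
filter-allTuples zero p M N M≤N bounded = refl
filter-allTuples (suc r) p M N M≤N bounded =
  begin
    filterᵇ p (allTuples N (suc r))
  ≡⟨ filterᵇ-prefixed p (λ _ → allTuples N r) (downFrom (suc N)) ⟩
    prefixed (λ c → filterᵇ (p ∘ (c ∷_)) (allTuples N r)) (downFrom (suc N))
  ≡⟨ prefixed-cong (downFrom (suc N)) (All.universal (λ c → filter-allTuples r (p ∘ (c ∷_)) M N M≤N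
       (λ t pt → All.tail (bounded (c ∷ t) pt))) _) ⟩
    prefixed J (downFrom (suc N))
  ≡⟨ cong (λ n → prefixed J (downFrom (suc n))) (sym (NP.m∸n+n≡m M≤N)) ⟩
    prefixed J (downFrom (suc (N ∸ M + M)))
  ≡⟨ prefixed-downFrom J M (N ∸ M) tooLarge ⟩
    prefixed J (downFrom (suc M))
  ≡⟨ sym (filterᵇ-prefixed p (λ _ → allTuples M r) (downFrom (suc M))) ⟩
    filterᵇ p (allTuples M (suc r))
  ∎
  where
  open ≡-Reasoning
  J : ℕ → List (List ℕ)
  J c = filterᵇ (p ∘ (c ∷_)) (allTuples M r)
  tooLarge : ∀ c → M < c → J c ≡ []
  tooLarge c M<c = LP.filter-none (T? ∘ (p ∘ (c ∷_)))
    (All.universal (λ t pt → NP.<⇒≱ M<c (All.head (bounded (c ∷ t) pt))) (allTuples M r))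

inS : ℕ → List ℕ → Bool
inS N t = (sum t ≡ᵇ N) ∧ all oddGe3 t

S-def : ∀ N r → S N r ≡ filterᵇ (inS N) (allTuples N r)
S-def N r = refl

entries≤sum : ∀ t → All (_≤ sum t) t
entries≤sum [] = []
entries≤sum (a ∷ t) = NP.m≤m+n a (sum t) ∷ All.map (λ le → NP.≤-trans le (NP.m≤n+m (sum t) a)) (entries≤sum t)

inS-bounded : ∀ N t → T (inS N t) → All (_≤ N) t
inS-bounded N t h = Eq.subst (λ s → All (_≤ s) t)
  (NP.≡ᵇ⇒≡ (sum t) N (proj₁ (Equivalence.to BP.T-∧ h))) (entries≤sum t)

≡ᵇ-shift : ∀ a N s → a ≤ N → (a + s ≡ᵇ N) ≡ (s ≡ᵇ N ∸ a)
≡ᵇ-shift zero N s le = refl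
≡ᵇ-shift (suc a) (suc N) s (s≤s le) = ≡ᵇ-shift a N s le

tails : ℕ → ℕ → ℕ → List (List ℕ)
tails N r c = if oddGe3 c then S (N ∸ c) r else []

filter-tails : ∀ N r c → c ≤ N → filterᵇ (inS N ∘ (c ∷_)) (allTuples N r) ≡ tails N r c
filter-tails N r c c≤N with oddGe3 c
... | false = LP.filter-none _ (All.universal (λ t → Eq.subst T (BP.∧-zeroʳ (c + sum t ≡ᵇ N))) (allTuples N r))
... | true = trans (filterᵇ-cong (λ t → cong (_∧ all oddGe3 t) (≡ᵇ-shift c N (sum t) c≤N)) (allTuples N r))
                   (filter-allTuples r (inS (N ∸ c)) (N ∸ c) N (NP.m∸n≤m N c) (inS-bounded (N ∸ c)))

S-split : ∀ N r → S N (suc r) ≡ prefixed (tails N r) (downFrom (suc N))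
S-split N r =
  begin
    S N (suc r)
  ≡⟨ S-def N (suc r) ⟩
    filterᵇ (inS N) (prefixed (λ _ → allTuples N r) (downFrom (suc N)))
  ≡⟨ filterᵇ-prefixed (inS N) (λ _ → allTuples N r) (downFrom (suc N)) ⟩
    prefixed (λ c → filterᵇ (inS N ∘ (c ∷_)) (allTuples N r)) (downFrom (suc N))
  ≡⟨ prefixed-cong (downFrom (suc N))
       (AllP.applyDownFrom⁺₁ (λ c → c) (suc N) (λ c<1+N → filter-tails N r _ (NP.≤-pred c<1+N))) ⟩
    prefixed (tails N r) (downFrom (suc N))
  ∎
  where open ≡-Reasoning

blockEntry : ℕ → List ℕ → List ℕ → ℤ
blockEntry k m n = if ⌊ LP.≡-dec NP._≟_ (take k m) (take k n) ⌋ then e (drop k m) (drop k n) else + 0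

E-def : ∀ j N r → E[ j ] N , r ≡ matrix (S N r) (blockEntry (r ∸ j))
E-def j N r = refl

≡-dec-∷ : ∀ c xs ys → ⌊ LP.≡-dec NP._≟_ (c ∷ xs) (c ∷ ys) ⌋ ≡ ⌊ LP.≡-dec NP._≟_ xs ys ⌋
≡-dec-∷ c xs ys = decided (LP.≡-dec NP._≟_ xs ys)
  where
  cons? = LP.≡-dec NP._≟_ (c ∷ xs) (c ∷ ys)
  decided : (d : Dec (xs ≡ ys)) → ⌊ cons? ⌋ ≡ ⌊ d ⌋
  decided (yes xs≡ys) = trans (isYes≗does cons?) (dec-true cons? (cong (c ∷_) xs≡ys))
  decided (no xs≢ys) = trans (isYes≗does cons?) (dec-false cons? (xs≢ys ∘ LP.∷-injectiveʳ))

blockEntry-diag : ∀ k c m n → blockEntry (suc k) (c ∷ m) (c ∷ n) ≡ blockEntry k m n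
blockEntry-diag k c m n =
  cong (λ b → if b then e (drop k m) (drop k n) else + 0) (≡-dec-∷ c (take k m) (take k n))

blockEntry-off : ∀ k c d m n → ¬ c ≡ d → blockEntry (suc k) (c ∷ m) (d ∷ n) ≡ + 0
blockEntry-off k c d m n c≢d = cong (λ b → if b then e (drop k m) (drop k n) else + 0)
  (trans (isYes≗does _) (dec-false (LP.≡-dec NP._≟_ (c ∷ take k m) (d ∷ take k n)) (c≢d ∘ LP.∷-injectiveˡ)))

tailBlock : ℕ → ℕ → ℕ → ℕ → Mat
tailBlock N r j c = matrix (tails N r c) (blockEntry (r ∸ j))

E-blocks : ∀ N r j → j ≤ r → E[ j ] N , suc r ≡ blockDiag (map (tailBlock N r j) (downFrom (suc N)))
E-blocks N r j j≤r =
  begin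
    E[ j ] N , suc r
  ≡⟨ E-def j N (suc r) ⟩
    matrix (S N (suc r)) (blockEntry (suc r ∸ j))
  ≡⟨ cong₂ (λ I k → matrix I (blockEntry k)) (S-split N r) (NP.+-∸-assoc 1 j≤r) ⟩
    matrix (prefixed (tails N r) (downFrom (suc N))) (blockEntry (suc (r ∸ j)))
  ≡⟨ matrix-prefixed (blockEntry (suc (r ∸ j))) (blockEntry (r ∸ j)) (tails N r) (downFrom (suc N))
       (blockEntry-diag (r ∸ j)) (blockEntry-off (r ∸ j)) (downFrom⁺ (suc N)) ⟩
    blockDiag (map (tailBlock N r j) (downFrom (suc N)))
  ∎
  where open ≡-Reasoning

mprod-empty : ∀ Bs → mprod [] Bs ≡ []
mprod-empty [] = refl
mprod-empty (B ∷ Bs) = refl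

guardedC : ℕ → ℕ → ℕ → Mat
guardedC N r c = if oddGe3 c then C (N ∸ c) , r else []

CProduct : List (List ℕ) → ℕ → Mat
CProduct I r = mprod (matrix I (blockEntry (r ∸ 2)))
                     (map (λ j → matrix I (blockEntry (r ∸ j))) (map (_+_ 3) (upTo (r ∸ 2))))

C-def : ∀ K r → C K , r ≡ CProduct (S K r) r
C-def K r = refl

CProduct-empty : ∀ r → CProduct [] r ≡ []
CProduct-empty r = mprod-empty (map (λ j → matrix [] (blockEntry (r ∸ j))) (map (_+_ 3) (upTo (r ∸ 2))))

tailBlock-product : ∀ N r c → CProduct (tails N r c) r ≡ guardedC N r c
tailBlock-product N r c = guarded (oddGe3 c)
  where
  guarded : (b : Bool) → CProduct (if b then S (N ∸ c) r else []) r ≡ (if b then C (N ∸ c) , r else [])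
  guarded true = refl
  guarded false = CProduct-empty r

Eprod-blocks : ∀ N q → Eprod N (3 + q) ≡ blockDiag (map (guardedC N (2 + q)) (downFrom (suc N)))
Eprod-blocks N q =
  begin
    Eprod N (3 + q)
  ≡⟨ cong₂ mprod (E-blocks N r 2 (s≤s (s≤s z≤n))) (LP.map-cong-local (AllP.map⁺ blocks)) ⟩
    mprod (blockDiag (map (tailBlock N r 2) cs)) (map (λ j → blockDiag (map (tailBlock N r j) cs)) js)
  ≡⟨ blockDiag-mprod (λ c → length (tails N r c)) (tailBlock N r 2) (tailBlock N r) cs js
       (λ c → Square-matrix _ _) (λ j c → Square-matrix _ _) ⟩
    blockDiag (map (λ c → mprod (tailBlock N r 2 c) (map (λ j → tailBlock N r j c) js)) cs)
  ≡⟨ cong blockDiag (LP.map-cong (tailBlock-product N r) cs) ⟩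
    blockDiag (map (guardedC N r) cs)
  ∎
  where
  open ≡-Reasoning
  r = 2 + q
  cs = downFrom (suc N)
  js = map (_+_ 3) (upTo q)
  blocks : All (λ i → E[ 3 + i ] N , suc r ≡ blockDiag (map (tailBlock N r (3 + i)) cs)) (upTo q)
  blocks = AllP.applyUpTo⁺₁ (λ i → i) q (λ i<q → E-blocks N r _ (s≤s (s≤s i<q)))

prefixed-empty : ∀ J cs → All (λ c → J c ≡ []) cs → prefixed J cs ≡ []
prefixed-empty J [] [] = refl
prefixed-empty J (c ∷ cs) (h ∷ hs) = cong₂ _++_ (cong (map (c ∷_)) h) (prefixed-empty J cs hs)

if-empty : ∀ {A : Set} (b : Bool) {X : List A} → (T b → X ≡ []) → (if b then X else []) ≡ []
if-empty true h = h _
if-empty false h = refl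

oddGe3⇒3≤ : ∀ c → T (oddGe3 c) → 3 ≤ c
oddGe3⇒3≤ c h = NP.≤ᵇ⇒≤ 3 c (proj₁ (Equivalence.to BP.T-∧ h))

∸-bound : ∀ {n c k} → c ≤ n → n < c + k → n ∸ c < k
∸-bound {n} {c} {k} c≤n n<c+k = Eq.subst (n ∸ c <_) (NP.m+n∸m≡n c k) (NP.∸-monoˡ-< n<c+k c≤n)

S-empty : ∀ r K → K < 3 * r → S K r ≡ []
S-empty zero K ()
S-empty (suc r) K K<3r+3 =
  trans (S-split K r) (prefixed-empty (tails K r) (downFrom (suc K))
    (AllP.applyDownFrom⁺₁ (λ c → c) (suc K) (λ {c} c<1+K → if-empty (oddGe3 c) (λ odd →
      S-empty r (K ∸ c) (∸-bound (NP.≤-pred c<1+K) (NP.<-≤-trans K<3+3r (NP.+-monoˡ-≤ (3 * r) (oddGe3⇒3≤ c odd))))))))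
  where
  K<3+3r : K < 3 + 3 * r
  K<3+3r = Eq.subst (K <_) (NP.*-suc 3 r) K<3r+3

guardedC-empty : ∀ N r c → c ≤ N → (3 ≤ c → N < c + 3 * r) → guardedC N r c ≡ []
guardedC-empty N r c c≤N small = if-empty (oddGe3 c) (λ odd →
  trans (C-def (N ∸ c) r)
    (trans (cong (λ I → CProduct I r) (S-empty r (N ∸ c) (∸-bound c≤N (small (oddGe3⇒3≤ c odd)))))
           (CProduct-empty r)))

blockDiag-[]∷ : ∀ Bs → blockDiag ([] ∷ Bs) ≡ blockDiag Bs
blockDiag-[]∷ Bs = LP.map-id (blockDiag Bs)

blockDiag-∷-cong : ∀ B {Bs Cs} → blockDiag Bs ≡ blockDiag Cs → blockDiag (B ∷ Bs) ≡ blockDiag (B ∷ Cs)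
blockDiag-∷-cong B eq = cong (λ R → map (_++ zeros (length R)) B ++ map (zeros (length B) ++_) R) eq

drop-empty-blocks : ∀ (f : ℕ → Mat) x y → (∀ c → y ≤ c → c < x + y → f c ≡ []) →
  blockDiag (map f (downFrom (x + y))) ≡ blockDiag (map f (downFrom y))
drop-empty-blocks f zero y h = refl
drop-empty-blocks f (suc x) y h =
  trans (cong (λ B → blockDiag (B ∷ map f (downFrom (x + y)))) (h (x + y) (NP.m≤n+m y x) NP.≤-refl))
  (trans (blockDiag-[]∷ (map f (downFrom (x + y))))
         (drop-empty-blocks f x y (λ c y≤c c<x+y → h c y≤c (NP.m<n⇒m<1+n c<x+y))))

%2-+2 : ∀ n → (2 + n) % 2 ≡ n % 2
%2-+2 n = trans (cong (_% 2) (NP.+-comm 2 n)) (DM.[m+n]%n≡m%n n 2)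

%2-suc : ∀ n → ¬ suc n % 2 ≡ n % 2
%2-suc zero ()
%2-suc (suc zero) ()
%2-suc (suc (suc n)) eq = %2-suc n (trans (sym (%2-+2 (suc n))) (trans eq (%2-+2 n)))

even-gap : ∀ d a → (a + d) % 2 ≡ a % 2 → ∃ λ q → d ≡ q + q
even-gap zero a eq = 0 , refl
even-gap (suc zero) a eq = ⊥-elim (%2-suc a (trans (cong (_% 2) (NP.+-comm 1 a)) eq))
even-gap (suc (suc d)) a eq with even-gap d a shorter
  where
  shift : a + suc (suc d) ≡ 2 + (a + d)
  shift = trans (NP.+-suc a (suc d)) (cong suc (NP.+-suc a d))
  shorter : (a + d) % 2 ≡ a % 2
  shorter = trans (sym (%2-+2 (a + d))) (trans (cong (_% 2) (sym shift)) eq)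
... | q , d≡2q = suc q , cong suc (trans (cong suc d≡2q) (sym (NP.+-suc q q)))

double : ∀ m → m * 2 ≡ m + m
double m = trans (NP.*-comm m 2) (cong (_+_ m) (NP.+-identityʳ m))

%2-+double : ∀ x m → (x + (m + m)) % 2 ≡ x % 2
%2-+double x m = trans (cong (λ k → (x + k) % 2) (sym (double m))) (DM.[m+kn]%n≡m%n x m 2)

large-form : ∀ N r → 3 * r < N → N % 2 ≡ suc r % 2 → ∃ λ q → N ≡ suc (3 * r + (q + q))
large-form N r 3r<N par with even-gap (N ∸ suc (3 * r)) (suc (3 * r)) sameParity
  where
  N≡ : suc (3 * r) + (N ∸ suc (3 * r)) ≡ N
  N≡ = NP.m+[n∸m]≡n 3r<N
  3r+1≡ : suc r + (r + r) ≡ suc (3 * r)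
  3r+1≡ = cong (λ k → suc (r + (r + k))) (sym (NP.+-identityʳ r))
  sameParity : (suc (3 * r) + (N ∸ suc (3 * r))) % 2 ≡ suc (3 * r) % 2
  sameParity = trans (cong (_% 2) N≡) (trans par (trans (sym (%2-+double (suc r) r)) (cong (_% 2) 3r+1≡)))
... | q , gap≡2q = q , trans (sym (NP.m+[n∸m]≡n 3r<N)) (cong (λ d → suc (3 * r) + d) gap≡2q)

oddGe3-odd : ∀ m → oddGe3 (3 + (m + m)) ≡ true
oddGe3-odd m = cong (_≡ᵇ 1) (%2-+double 3 m)

oddGe3-even : ∀ m → oddGe3 (2 + (m + m)) ≡ false
oddGe3-even m = trans (cong (λ k → (3 Data.Nat.≤ᵇ (2 + (m + m))) ∧ (k ≡ᵇ 1)) (%2-+double 2 m)) (BP.∧-zeroʳ _)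

pairs : ∀ N r m (g : ℕ → ℕ) → (∀ i → g (suc i) ≡ 2 + g i) → N ≡ suc (m + m + g 0) →
  blockDiag (map (guardedC N r) (downFrom (2 + (m + m)))) ≡ blockDiag (applyUpTo (λ i → C (g i) , r) m)
pairs N r zero g step N≡ = refl
pairs N r (suc m) g step N≡ =
  begin
    blockDiag (map (guardedC N r) (downFrom (2 + (suc m + suc m))))
  ≡⟨ cong (λ x → blockDiag (map (guardedC N r) (downFrom (2 + x)))) (NP.+-suc (suc m) m) ⟩
    blockDiag (guardedC N r (3 + (m + m)) ∷ guardedC N r (2 + (m + m)) ∷ rest)
  ≡⟨ cong₂ (λ A B → blockDiag (A ∷ B ∷ rest)) oddBlock evenBlock ⟩
    blockDiag (C (g 0) , r ∷ [] ∷ rest)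
  ≡⟨ blockDiag-∷-cong (C (g 0) , r) {[] ∷ rest} {applyUpTo (λ i → C (g (suc i)) , r) m} (trans (blockDiag-[]∷ rest) (pairs N r m (g ∘ suc) (step ∘ suc) N≡′)) ⟩
    blockDiag (applyUpTo (λ i → C (g i) , r) (suc m))
  ∎
  where
  open ≡-Reasoning
  rest = map (guardedC N r) (downFrom (2 + (m + m)))
  N≡3+2m+g0 : N ≡ 3 + (m + m) + g 0
  N≡3+2m+g0 = trans N≡ (cong (λ k → suc (suc k + g 0)) (NP.+-suc m m))
  oddBlock : guardedC N r (3 + (m + m)) ≡ C (g 0) , r
  oddBlock = trans (cong (λ b → if b then C (N ∸ (3 + (m + m))) , r else []) (oddGe3-odd m))
    (cong (λ K → C K , r) (trans (cong (_∸ (3 + (m + m))) N≡3+2m+g0) (NP.m+n∸m≡n (3 + (m + m)) (g 0))))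
  evenBlock : guardedC N r (2 + (m + m)) ≡ []
  evenBlock = cong (λ b → if b then C (N ∸ (2 + (m + m))) , r else []) (oddGe3-even m)
  regroup : ∀ m x → suc (suc m + suc m + x) ≡ suc (m + m + (2 + x))
  regroup = solve-∀
  N≡′ : N ≡ suc (m + m + g 1)
  N≡′ = trans N≡ (trans (regroup m (g 0)) (cong (λ x → suc (m + m + x)) (sym (step 0))))

blocks-small : ∀ N r → N ≤ 3 * r →
  blockDiag (map (guardedC N r) (downFrom (suc N))) ≡ blockDiag (map (λ K → C K , r) (blockSizes N (suc r)))
blocks-small N r N≤3r =
  begin
    blockDiag (map (guardedC N r) (downFrom (suc N)))
  ≡⟨ cong (λ n → blockDiag (map (guardedC N r) (downFrom n))) (sym (NP.+-identityʳ (suc N))) ⟩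
    blockDiag (map (guardedC N r) (downFrom (suc N + 0)))
  ≡⟨ drop-empty-blocks (guardedC N r) (suc N) 0 (λ c _ c<1+N → guardedC-empty N r c
       (NP.≤-pred (Eq.subst (c <_) (NP.+-identityʳ (suc N)) c<1+N))
       (λ 3≤c → NP.≤-<-trans N≤3r (NP.+-monoˡ-≤ (3 * r) (NP.≤-trans (s≤s z≤n) 3≤c)))) ⟩
    []
  ≡⟨ cong (λ n → blockDiag (map (λ K → C K , r) (map (λ i → (3 * suc r ∸ 3) + 2 * i) (upTo (n / 2))))) (sym noBlocks) ⟩
    blockDiag (map (λ K → C K , r) (blockSizes N (suc r)))
  ∎
  where
  open ≡-Reasoning
  N+2≤ : N + 2 ≤ 3 * suc r
  N+2≤ = Eq.subst (N + 2 ≤_) (trans (NP.+-comm (3 * r) 3) (sym (NP.*-suc 3 r)))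
           (NP.+-mono-≤ N≤3r (s≤s (s≤s z≤n)))
  noBlocks : N + 2 ∸ 3 * suc r ≡ 0
  noBlocks = NP.m≤n⇒m∸n≡0 N+2≤

blocks-large : ∀ N r q → N ≡ suc (3 * r + (q + q)) →
  blockDiag (map (guardedC N r) (downFrom (suc N))) ≡ blockDiag (map (λ K → C K , r) (blockSizes N (suc r)))
blocks-large N r q N≡ =
  begin
    blockDiag (map (guardedC N r) (downFrom (suc N)))
  ≡⟨ cong (λ n → blockDiag (map (guardedC N r) (downFrom n))) 1+N≡ ⟩
    blockDiag (map (guardedC N r) (downFrom (3 * r + (2 + (q + q)))))
  ≡⟨ drop-empty-blocks (guardedC N r) (3 * r) (2 + (q + q)) (λ c 2+2q≤c c<1+N →
       guardedC-empty N r c (NP.≤-pred (Eq.subst (c <_) (sym 1+N≡) c<1+N))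
         (λ _ → Eq.subst (_≤ c + 3 * r) (trans (NP.+-comm (2 + (q + q)) (3 * r)) (sym 1+N≡))
                  (NP.+-monoˡ-≤ (3 * r) 2+2q≤c))) ⟩
    blockDiag (map (guardedC N r) (downFrom (2 + (q + q))))
  ≡⟨ pairs N r q g (λ i → step (3 * suc r ∸ 3) i) N≡2q+g0 ⟩
    blockDiag (applyUpTo (λ i → C (g i) , r) q)
  ≡⟨ cong (λ n → blockDiag (applyUpTo (λ i → C (g i) , r) n)) (sym count) ⟩
    blockDiag (applyUpTo (λ i → C (g i) , r) ((N + 2 ∸ 3 * suc r) / 2))
  ≡⟨ cong blockDiag (sym (trans (sym (LP.map-∘ (upTo ((N + 2 ∸ 3 * suc r) / 2)))) (LP.map-upTo _ _))) ⟩
    blockDiag (map (λ K → C K , r) (blockSizes N (suc r)))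
  ∎
  where
  open ≡-Reasoning
  g : ℕ → ℕ
  g i = (3 * suc r ∸ 3) + 2 * i
  3r+3∸3≡3r : 3 * suc r ∸ 3 ≡ 3 * r
  3r+3∸3≡3r = trans (cong (_∸ 3) (NP.*-suc 3 r)) (NP.m+n∸m≡n 3 (3 * r))
  step : ∀ B i → B + 2 * suc i ≡ 2 + (B + 2 * i)
  step = solve-∀
  shift₁ : ∀ A q → suc (suc (A + (q + q))) ≡ A + (2 + (q + q))
  shift₁ = solve-∀
  shift₂ : ∀ A q → suc (A + (q + q)) ≡ suc (q + q + (A + 2 * 0))
  shift₂ = solve-∀
  shift₃ : ∀ A q → suc (A + (q + q)) + 2 ≡ (3 + A) + (q + q)
  shift₃ = solve-∀
  1+N≡ : suc N ≡ 3 * r + (2 + (q + q))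
  1+N≡ = trans (cong suc N≡) (shift₁ (3 * r) q)
  N≡2q+g0 : N ≡ suc (q + q + g 0)
  N≡2q+g0 = trans N≡ (trans (shift₂ (3 * r) q) (cong (λ B → suc (q + q + (B + 2 * 0))) (sym 3r+3∸3≡3r)))
  count : (N + 2 ∸ 3 * suc r) / 2 ≡ q
  count = trans (cong (_/ 2) (trans (cong₂ _∸_ (trans (cong (_+ 2) N≡) (shift₃ (3 * r) q)) (NP.*-suc 3 r))
                                       (NP.m+n∸m≡n (3 + 3 * r) (q + q))))
                (trans (cong (_/ 2) (sym (double q))) (DM.m*n/n≡m q 2))

guardedC-blocks : ∀ N r → N % 2 ≡ suc r % 2 →
  blockDiag (map (guardedC N r) (downFrom (suc N))) ≡ blockDiag (map (λ K → C K , r) (blockSizes N (suc r)))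
guardedC-blocks N r par with N ≤? 3 * r
... | yes N≤3r = blocks-small N r N≤3r
... | no N≰3r with large-form N r (NP.≰⇒> N≰3r) par
...   | q , N≡ = blocks-large N r q N≡

corollary4p2 : (N r : ℕ) → 1 ≤ N → 3 ≤ r → N % 2 ≡ r % 2 →
    Eprod N r ≡ blockDiag (map (λ K → C K , (r ∸ 1)) (blockSizes N r))
corollary4p2 N (suc (suc (suc q))) _ (s≤s (s≤s (s≤s _))) par =
  trans (Eprod-blocks N q) (guardedC-blocks N (2 + q) par)
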